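{- Let $G$ be a subgraph of $K_n$ with exactly $m$ bridges, and let $H$ be the graph consisting of the edges of $G$ that are not bridges (the union of the biconnected components of $G$). Then: (1) $q_0(\emptyset)=1$, $q_0(G)=1/2$ if $G$ is a single edge, and $q_0(G)\le1/4$ for every $G$ with at least two edges; (2) if $m=0$ and $|G|$ is odd, then either $q_0(G)\le1/16$, or $G$ is a triangle, or $G$ is isomorphic to $K_4^-$; (3) either $H$ has no edges, or $q_0(H)\le 1/4$.
   Context: Graphs are identified with their edge sets; $|G|$ is the number of edges and $\emptyset$ the edgeless graph. Let $(V_1,V_2)$ be a random bipartition of $[n]$, each vertex independently in either part with probability $1/2$, and $B$ the set of edges between the parts; $q_0(G)=\Pr[|G\cap B|=0]$. A bridge is an edge whose removal increases the number of connected components. $K_4^-$ is the graph on 4 vertices with 5 edges. -}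

module Defs where

open import Data.Bool using (Bool; true; false; _∧_; _∨_; not; if_then_else_)
open import Data.Nat using (ℕ; zero; suc; _+_; _*_; _^_; _<ᵇ_; _≡ᵇ_)
open import Data.Nat.Properties using (m^n≢0)
open import Data.Fin using (Fin; toℕ; _≟_)
open import Data.List using (List; []; _∷_; map; concatMap; filter; length)
open import Data.List.Base using (allFin)
open import Data.Bool.ListAction using (all; any)
open import Data.Vec using (Vec; []; _∷_; lookup)
open import Data.Product using (_×_; _,_; ∃; ∃-syntax)
open import Data.Integer using (+_)
open import Data.Rational using (ℚ; _/_)
open import Relation.Binary.PropositionalEquality using (_≡_; _≢_)
open import Relation.Nullary.Decidable using (⌊_⌋)
open import Relation.Unary using (Pred)
open import Function.Bundles using (_⇔_)
open import Data.Empty using (⊥)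

-- A graph on vertex set [n] = Fin n, given by its (Boolean) adjacency relation.
-- Graphs are identified with their edge sets {u,v} with G u v ≡ true.
Graph : ℕ → Set
Graph n = Fin n → Fin n → Bool

IsSubgraphOfK : ∀ {n} → Graph n → Set
IsSubgraphOfK {n} G = (∀ u v → G u v ≡ G v u) × (∀ u → G u u ≡ false)

emptyG : ∀ {n} → Graph n
emptyG _ _ = false

pairs : ∀ n → List (Fin n × Fin n)
pairs n = concatMap (λ i → map (λ j → (i , j)) (filter (λ j → toℕ i Data.Nat.<? toℕ j) (allFin n))) (allFin n)

countTrue : ∀ {A : Set} → (A → Bool) → List A → ℕ
countTrue p xs = length (filter (λ x → Data.Bool.T? (p x)) xs)

∣_∣ₑ : ∀ {n} → Graph n → ℕ
∣_∣ₑ {n} G = countTrue (λ { (i , j) → G i j }) (pairs n)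

reach : ∀ {n} → Graph n → ℕ → Fin n → Fin n → Bool
reach G zero u v = ⌊ u ≟ v ⌋
reach {n} G (suc k) u v = reach G k u v ∨ any (λ w → reach G k u w ∧ G w v) (allFin n)

-- connected: walk of length ≤ n (enough on n vertices)
connected : ∀ {n} → Graph n → Fin n → Fin n → Bool
connected {n} G = reach G n

-- number of connected components of G (as a graph on vertex set [n]):
-- number of vertices that are the least vertex of their component
components : ∀ {n} → Graph n → ℕ
components {n} G =
  countTrue (λ v → not (any (λ w → (toℕ w Data.Nat.<ᵇ toℕ v) ∧ connected G w v) (allFin n))) (allFin n)

samePair : ∀ {n} → Fin n → Fin n → Fin n → Fin n → Bool
samePair u v x y = (⌊ x ≟ u ⌋ ∧ ⌊ y ≟ v ⌋) ∨ (⌊ x ≟ v ⌋ ∧ ⌊ y ≟ u ⌋)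

removeEdge : ∀ {n} → Graph n → Fin n → Fin n → Graph n
removeEdge G u v x y = G x y ∧ not (samePair u v x y)

isBridge : ∀ {n} → Graph n → Fin n → Fin n → Bool
isBridge G u v = G u v ∧ (components G <ᵇ components (removeEdge G u v))

bridgeCount : ∀ {n} → Graph n → ℕ
bridgeCount {n} G = countTrue (λ { (i , j) → isBridge G i j }) (pairs n)

nonBridgePart : ∀ {n} → Graph n → Graph n
nonBridgePart G u v = G u v ∧ not (isBridge G u v)

-- all 2^n assignments V → Bool, i.e. all bipartitions (V₁ = f⁻¹ true, V₂ = f⁻¹ false)
allVecs : ∀ n → List (Vec Bool n)
allVecs zero = [] ∷ []
allVecs (suc n) = concatMap (λ v → (true ∷ v) ∷ (false ∷ v) ∷ []) (allVecs n)

noCrossing : ∀ {n} → Graph n → Vec Bool n → Bool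
noCrossing {n} G f =
  all (λ { (i , j) → not (G i j) ∨ not (Data.Bool._xor_ (lookup f i) (lookup f j)) }) (pairs n)

-- q₀(G) = Pr[ |G ∩ B| = 0 ] for a uniformly random bipartition
q₀ : ∀ {n} → Graph n → ℚ
q₀ {n} G = (+ countTrue (noCrossing G) (allVecs n)) / (2 ^ n)
  where instance _ = m^n≢0 2 n

IsTriangle : ∀ {n} → Graph n → Set
IsTriangle {n} G = ∃[ a ] ∃[ b ] ∃[ c ] (a ≢ b × b ≢ c × a ≢ c ×
  (∀ x y → G x y ≡ (samePair a b x y ∨ samePair b c x y ∨ samePair a c x y)))

IsK4minus : ∀ {n} → Graph n → Set
IsK4minus {n} G = ∃[ a ] ∃[ b ] ∃[ c ] ∃[ d ]
  (a ≢ b × a ≢ c × a ≢ d × b ≢ c × b ≢ d × c ≢ d ×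
  (∀ x y → G x y ≡ (samePair a b x y ∨ samePair a c x y ∨ samePair a d x y
                    ∨ samePair b c x y ∨ samePair b d x y)))

-- A forest with k edges inside G forces q₀(G) ≤ 2⁻ᵏ: moving one leaf to the other side of a bipartition is an
-- involution that toggles whether the leaf's edge is cut and fixes the other forest edges, so peeling off leaves
-- shows that exactly 2ⁿ⁻ᵏ bipartitions cut no forest edge. Two distinct edges contain a 2-edge forest; a single
-- edge gives equality. A non-bridge uv lies on a cycle: on a walk from u to v avoiding uv, the edge wv by which v
-- is first reached is again not a bridge, so H has two edges as soon as it has one. A bridgeless graph has no
-- vertex of degree one, so growing a forest from an edge either reaches four edges (q₀ ≤ 1/16) or gets stuck with
-- all edges on three or four vertices of degree at least two: a triangle, or K₄⁻ once the odd edge count rules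
-- out C₄ and K₄.

module Submission where

open import Defs
open import Data.Nat using (ℕ; _≤_; _*_; _+_)
open import Data.Rational using (ℚ; 1ℚ; ½; _/_) renaming (_≤_ to _≤ℚ_)
open import Data.Integer using (+_)
open import Data.Product using (_×_; ∃-syntax)
open import Data.Sum using (_⊎_)
open import Relation.Binary.PropositionalEquality using (_≡_)

open import Data.Bool using (Bool; true; false; T; T?; not; _∧_; _∨_; _xor_; if_then_else_)
open import Data.Bool.ListAction using (all; any; or)
open import Data.Bool.Properties
  using (T-∧; T-∨; T-≡; T-not-≡; ∨-identityʳ; ∨-comm; ∧-identityʳ; not-distribˡ-xor; xor-comm; xor-same)
open import Data.Empty using (⊥-elim)
open import Data.Fin using (Fin; toℕ; _≟_)
open import Data.Fin.Properties using (toℕ-injective)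
import Data.Integer as ℤ
open import Data.Integer using (+≤+)
open import Data.Integer.Properties using (pos-*)
open import Data.List using (List; []; _∷_; _++_; map; concatMap; length; filter)
open import Data.List.Base using (allFin)
open import Data.List.Membership.Propositional using (_∈_; _∉_; find)
open import Data.List.Membership.Propositional.Properties
  using (∈-++⁺ˡ; ∈-++⁺ʳ; ∈-++⁻; ∈-concatMap⁺; ∈-concatMap⁻; ∈-map⁺; ∈-map⁻; ∈-filter⁺; ∈-filter⁻; ∈-allFin)
open import Data.List.Properties using (map-cong; length-tabulate; length-filter; filter-reject)
open import Data.List.Relation.Binary.Disjoint.Propositional using (Disjoint)
open import Data.List.Relation.Binary.Permutation.Propositional using (_↭_; ↭⇒↭ₛ; prep; swap; ↭-refl; ↭-trans)
open import Data.List.Relation.Binary.Permutation.Propositional.Properties using (∈-resp-↭; shift; shifts)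
import Data.List.Relation.Binary.Permutation.Setoid.Properties as Permutation
open import Data.List.Relation.Unary.All using (All; []; _∷_; all?)
import Data.List.Relation.Unary.All as All
open import Data.List.Relation.Unary.All.Properties using (all⁺; all⁻; ¬All⇒Any¬)
import Data.List.Relation.Unary.All.Properties as All
open import Data.List.Relation.Unary.AllPairs using (AllPairs; []; _∷_)
import Data.List.Relation.Unary.AllPairs as AllPairs
import Data.List.Relation.Unary.AllPairs.Properties as AllPairs
open import Data.List.Relation.Unary.Any using (here; there)
import Data.List.Relation.Unary.Any as Any
open import Data.List.Relation.Unary.Any.Properties using (any⁺; any⁻)
open import Data.List.Relation.Unary.Unique.Propositional using (Unique)
open import Data.List.Relation.Unary.Unique.Propositional.Properties using (allFin⁺)
import Data.List.Relation.Unary.Unique.Propositional.Properties as Unique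
open import Data.Nat using (zero; suc; z≤n; s≤s; s≤s⁻¹; _<_; _<ᵇ_; _<?_; _^_; NonZero)
open import Data.Nat.Properties
  using ( +-comm; +-suc; +-identityʳ; +-mono-≤; *-comm; *-assoc; *-identityʳ; *-monoˡ-≤; m^n≢0; even≢odd
        ; ≤-refl; ≤-reflexive; ≤-trans; ≤-antisym; m≤n+m; m≤n⇒m≤1+n; <-cmp; <-irrefl; <-asym; <ᵇ⇒<; <⇒<ᵇ
        ; module ≤-Reasoning )
open import Algebra.Properties.CommutativeSemigroup Data.Nat.Properties.+-commutativeSemigroup
  using () renaming (interchange to +-interchange)
open import Data.Product using (_,_; proj₁; proj₂; uncurry)
open import Data.Product.Properties using (≡-dec)
open import Data.Rational.Properties using (fromℚᵘ-cong; toℚᵘ-cancel-≤; toℚᵘ-fromℚᵘ)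
open import Data.Rational.Unnormalised using (mkℚᵘ; *≡*; *≤*)
import Data.Rational.Unnormalised.Properties as ℚᵘ
open import Data.Sum using (inj₁; inj₂)
open import Data.Vec using (Vec; []; _∷_; lookup; updateAt)
open import Data.Vec.Properties using (lookup∘updateAt; lookup∘updateAt′)
open import Function using (_∘_; id; flip; case_of_; _⇔_; mk⇔; Equivalence)
open import Relation.Binary.Construct.Closure.ReflexiveTransitive using (Star; ε; _◅_; _◅◅_)
import Relation.Binary.Construct.Closure.ReflexiveTransitive as Star
open import Relation.Binary.Definitions using (tri<; tri≈; tri>)
open import Relation.Binary.PropositionalEquality
  using (_≢_; refl; sym; trans; cong; cong₂; subst; subst₂; module ≡-Reasoning)
open import Relation.Nullary using (¬_; ¬?; yes; no; Dec; _×-dec_)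
open import Relation.Nullary.Decidable using (⌊_⌋; toWitness; fromWitness; toWitnessFalse; fromWitnessFalse)

open Equivalence using (to; from)

private variable
  A : Set
  n : ℕ
  p q : A → Bool
  a b : Bool
  x y : A
  xs : List A

T-ext : (T a → T b) → (T b → T a) → a ≡ b
T-ext {false} {false} _ _ = refl
T-ext {false} {true}  _ g = ⊥-elim (g _)
T-ext {true}  {false} f _ = ⊥-elim (f _)
T-ext {true}  {true}  _ _ = refl

T-not : T (not a) ⇔ (¬ T a)
T-not {true}  = mk⇔ (λ ()) (λ ¬t → ¬t _)
T-not {false} = mk⇔ (λ _ ()) (λ _ → _)

T-stable : ¬ ¬ T a → T a
T-stable {true}  _   = _
T-stable {false} ¬¬t = ¬¬t (λ ())

countTrue-reject : ¬ T (p x) → countTrue p (x ∷ xs) ≡ countTrue p xs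
countTrue-reject {p = p} ¬px = cong length (filter-reject (λ z → T? (p z)) ¬px)

countTrue-mono : (∀ x → T (p x) → T (q x)) → ∀ xs → countTrue p xs ≤ countTrue q xs
countTrue-mono h [] = z≤n
countTrue-mono {p = p} {q = q} h (x ∷ xs) with p x in px | q x in qx
... | true  | true  = s≤s (countTrue-mono h xs)
... | false | true  = m≤n⇒m≤1+n (countTrue-mono h xs)
... | false | false = countTrue-mono h xs
... | true  | false = ⊥-elim (subst T qx (h x (subst T (sym px) _)))

countTrue-cong : (∀ x → p x ≡ q x) → ∀ xs → countTrue p xs ≡ countTrue q xs
countTrue-cong h xs =
  ≤-antisym (countTrue-mono (λ x → subst T (h x)) xs) (countTrue-mono (λ x → subst T (sym (h x))) xs)

countTrue-< : (∀ x → T (p x) → T (q x)) → x ∈ xs → T (q x) → ¬ T (p x) →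
  countTrue p xs < countTrue q xs
countTrue-< {p = p} {q = q} {x = x} {xs = _ ∷ ys} h (here refl) qx ¬px with p x | q x
... | false | true  = s≤s (countTrue-mono h ys)
... | true  | _     = ⊥-elim (¬px _)
countTrue-< {p = p} {q = q} {xs = y ∷ _} h (there x∈) qx ¬px with p y in py | q y in qy
... | true  | true  = s≤s (countTrue-< h x∈ qx ¬px)
... | false | true  = m≤n⇒m≤1+n (countTrue-< h x∈ qx ¬px)
... | false | false = countTrue-< h x∈ qx ¬px
... | true  | false = ⊥-elim (subst T qy (h y (subst T (sym py) _)))

countTrue-pos : x ∈ xs → T (p x) → 1 ≤ countTrue p xs
countTrue-pos x∈ px = ≤-trans (s≤s z≤n) (countTrue-< {p = λ _ → false} (λ _ ()) x∈ px (λ ()))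

countTrue-≥2 : x ∈ xs → y ∈ xs → x ≢ y → T (p x) → T (p y) → 2 ≤ countTrue p xs
countTrue-≥2 (here refl) (here refl) x≢y _ _ = ⊥-elim (x≢y refl)
countTrue-≥2 {x = x} {p = p} (here refl) (there y∈) _ px py with p x
... | true = s≤s (countTrue-pos y∈ py)
countTrue-≥2 {y = y} {p = p} (there x∈) (here refl) _ px py with p y
... | true = s≤s (countTrue-pos x∈ px)
countTrue-≥2 {xs = z ∷ _} {p = p} (there x∈) (there y∈) x≢y px py with p z
... | true  = m≤n⇒m≤1+n (countTrue-≥2 x∈ y∈ x≢y px py)
... | false = countTrue-≥2 x∈ y∈ x≢y px py

countTrue-witness : ∀ xs → 1 ≤ countTrue p xs → ∃[ x ] (x ∈ xs × T (p x))
countTrue-witness {p = p} (x ∷ xs) h with p x in px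
... | true  = x , here refl , subst T (sym px) _
... | false with countTrue-witness xs h
... | y , y∈ , py = y , there y∈ , py

countTrue-two-witnesses : Unique xs → 2 ≤ countTrue p xs →
  ∃[ x ] ∃[ y ] (x ∈ xs × y ∈ xs × x ≢ y × T (p x) × T (p y))
countTrue-two-witnesses {xs = x ∷ xs} {p = p} (x∉ ∷ u) h with p x in px
... | false with countTrue-two-witnesses u h
...   | y , z , y∈ , z∈ , y≢z , py , pz = y , z , there y∈ , there z∈ , y≢z , py , pz
countTrue-two-witnesses {xs = x ∷ xs} {p = p} (x∉ ∷ u) (s≤s h) | true with countTrue-witness xs h
...   | y , y∈ , py = x , y , here refl , there y∈ , All.lookup x∉ y∈ , subst T (sym px) _ , py

countTrue-none : (∀ y → y ∈ xs → ¬ T (p y)) → countTrue p xs ≡ 0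
countTrue-none {xs = []} _ = refl
countTrue-none {xs = y ∷ ys} {p = p} none =
  trans (countTrue-reject {p = p} (none y (here refl))) (countTrue-none (λ z → none z ∘ there))

countTrue-≤1 : Unique xs → (∀ y → y ∈ xs → T (p y) → y ≡ x) → countTrue p xs ≤ 1
countTrue-≤1 {xs = []} _ _ = z≤n
countTrue-≤1 {xs = y ∷ ys} {p = p} (y∉ ∷ u) only with p y in py
... | false = countTrue-≤1 u (λ z z∈ → only z (there z∈))
... | true  = s≤s (≤-reflexive (countTrue-none λ z z∈ pz →
      All.lookup y∉ z∈ (trans (only y (here refl) (subst T (sym py) _)) (sym (only z (there z∈) pz)))))

countTrue-zero : countTrue p xs ≡ 0 → x ∈ xs → ¬ T (p x)
countTrue-zero c x∈ px with subst (1 ≤_) c (countTrue-pos x∈ px)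
... | ()

countTrue-∨ : ∀ {A : Set} {p q : A → Bool} xs → (∀ {x} → x ∈ xs → T (p x) → ¬ T (q x)) →
  countTrue (λ x → p x ∨ q x) xs ≡ countTrue p xs + countTrue q xs
countTrue-∨ [] _ = refl
countTrue-∨ {p = p} {q} (x ∷ xs) disjoint with p x in px | q x in qx
... | false | false = countTrue-∨ xs (disjoint ∘ there)
... | false | true  = trans (cong suc (countTrue-∨ xs (disjoint ∘ there))) (sym (+-suc _ _))
... | true  | false = cong suc (countTrue-∨ xs (disjoint ∘ there))
... | true  | true  = ⊥-elim (disjoint (here refl) (subst T (sym px) _) (subst T (sym qx) _))

countTrue-map-id : ∀ {A : Set} (f : A → Bool) xs → countTrue f xs ≡ countTrue id (map f xs)
countTrue-map-id f [] = refl
countTrue-map-id f (x ∷ xs) with f x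
... | true  = cong suc (countTrue-map-id f xs)
... | false = countTrue-map-id f xs

countTrue-concatMap-cons : ∀ (p : Vec Bool (suc n) → Bool) vs →
  countTrue p (concatMap (λ v → (true ∷ v) ∷ (false ∷ v) ∷ []) vs)
    ≡ countTrue (p ∘ (true ∷_)) vs + countTrue (p ∘ (false ∷_)) vs
countTrue-concatMap-cons p [] = refl
countTrue-concatMap-cons p (v ∷ vs) with p (true ∷ v)
... | true with p (false ∷ v)
...   | true  = cong suc (trans (cong suc (countTrue-concatMap-cons p vs)) (sym (+-suc _ _)))
...   | false = cong suc (countTrue-concatMap-cons p vs)
countTrue-concatMap-cons p (v ∷ vs) | false with p (false ∷ v)
...   | true  = trans (cong suc (countTrue-concatMap-cons p vs)) (sym (+-suc _ _))
...   | false = countTrue-concatMap-cons p vs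

countVecs : ∀ n → (Vec Bool n → Bool) → ℕ
countVecs zero    p = if p [] then 1 else 0
countVecs (suc n) p = countVecs n (p ∘ (true ∷_)) + countVecs n (p ∘ (false ∷_))

countTrue-allVecs : ∀ n (p : Vec Bool n → Bool) → countTrue p (allVecs n) ≡ countVecs n p
countTrue-allVecs zero p with p []
... | true  = refl
... | false = refl
countTrue-allVecs (suc n) p =
  trans (countTrue-concatMap-cons p (allVecs n)) (cong₂ _+_ (countTrue-allVecs n _) (countTrue-allVecs n _))

countVecs-mono : ∀ n {p q : Vec Bool n → Bool} → (∀ v → T (p v) → T (q v)) → countVecs n p ≤ countVecs n q
countVecs-mono zero {p} {q} h with p [] | q [] | h []
... | false | _     | _  = z≤n
... | true  | true  | _  = s≤s z≤n
... | true  | false | h₀ = ⊥-elim (h₀ _)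
countVecs-mono (suc n) h = +-mono-≤ (countVecs-mono n (h ∘ (true ∷_))) (countVecs-mono n (h ∘ (false ∷_)))

countVecs-cong : ∀ n {p q : Vec Bool n → Bool} → (∀ v → p v ≡ q v) → countVecs n p ≡ countVecs n q
countVecs-cong n h =
  ≤-antisym (countVecs-mono n (λ v → subst T (h v))) (countVecs-mono n (λ v → subst T (sym (h v))))

countVecs-split : ∀ n (p q : Vec Bool n → Bool) →
  countVecs n p ≡ countVecs n (λ v → q v ∧ p v) + countVecs n (λ v → not (q v) ∧ p v)
countVecs-split zero p q with q []
... | true  = sym (+-identityʳ _)
... | false = refl
countVecs-split (suc n) p q = trans
  (cong₂ _+_ (countVecs-split n (p ∘ (true ∷_)) (q ∘ (true ∷_)))
             (countVecs-split n (p ∘ (false ∷_)) (q ∘ (false ∷_))))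
  (+-interchange (countVecs n (λ v → q (true ∷ v) ∧ p (true ∷ v))) _
                 (countVecs n (λ v → q (false ∷ v) ∧ p (false ∷ v))) _)

countVecs-all : ∀ n → countVecs n (λ _ → true) ≡ 2 ^ n
countVecs-all zero = refl
countVecs-all (suc n) = cong₂ _+_ (countVecs-all n) (trans (countVecs-all n) (sym (+-identityʳ _)))

flipAt : Fin n → Vec Bool n → Vec Bool n
flipAt t v = updateAt v t not

countVecs-flipAt : ∀ n (t : Fin n) (p : Vec Bool n → Bool) → countVecs n (p ∘ flipAt t) ≡ countVecs n p
countVecs-flipAt (suc n) Fin.zero p = +-comm (countVecs n (p ∘ (false ∷_))) (countVecs n (p ∘ (true ∷_)))
countVecs-flipAt (suc n) (Fin.suc t) p =
  cong₂ _+_ (countVecs-flipAt n t (p ∘ (true ∷_))) (countVecs-flipAt n t (p ∘ (false ∷_)))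

sameSide : Vec Bool n → Fin n → Fin n → Bool
sameSide v x y = not (lookup v x xor lookup v y)

sameSide-flipAt : ∀ {t x : Fin n} → t ≢ x → ∀ v → sameSide (flipAt t v) t x ≡ not (sameSide v t x)
sameSide-flipAt {t = t} {x} t≢x v = cong not (trans
  (cong₂ _xor_ (lookup∘updateAt t v) (lookup∘updateAt′ x t (t≢x ∘ sym) v))
  (sym (not-distribˡ-xor (lookup v t) (lookup v x))))

sameSide-flipAt-away : ∀ {t x y : Fin n} → t ≢ x → t ≢ y → ∀ v → sameSide (flipAt t v) x y ≡ sameSide v x y
sameSide-flipAt-away {t = t} {x} {y} t≢x t≢y v =
  cong not (cong₂ _xor_ (lookup∘updateAt′ x t (t≢x ∘ sym) v) (lookup∘updateAt′ y t (t≢y ∘ sym) v))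

-- Flipping t permutes the assignments, preserves P and toggles whether t and x are on the same side.
countVecs-halve : ∀ n {t x : Fin n} (P : Vec Bool n → Bool) → t ≢ x → (∀ v → P (flipAt t v) ≡ P v) →
  countVecs n (λ v → sameSide v t x ∧ P v) * 2 ≡ countVecs n P
countVecs-halve n {t} {x} P t≢x P-inv = begin
  k * 2                                     ≡⟨ *-comm k 2 ⟩
  k + (k + 0)                               ≡⟨ cong (_+_ k) (+-identityʳ k) ⟩
  k + k                                     ≡⟨ cong (_+_ k) k≡flipped ⟩
  k + countVecs n (λ v → not (E v) ∧ P v)   ≡⟨ sym (countVecs-split n P E) ⟩
  countVecs n P                             ∎
  where
  open ≡-Reasoning
  E : Vec Bool n → Bool
  E v = sameSide v t x
  k = countVecs n (λ v → E v ∧ P v)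
  k≡flipped : k ≡ countVecs n (λ v → not (E v) ∧ P v)
  k≡flipped = trans (sym (countVecs-flipAt n t (λ v → E v ∧ P v)))
    (countVecs-cong n (λ v → cong₂ _∧_ (sameSide-flipAt t≢x v) (P-inv v)))

pairsRow : Fin n → List (Fin n × Fin n)
pairsRow {n} i = map (i ,_) (filter (λ k → toℕ i <? toℕ k) (allFin n))

pairs-mem : ∀ {i j : Fin n} → toℕ i < toℕ j → (i , j) ∈ pairs n
pairs-mem {n} {i} {j} i<j = ∈-concatMap⁺ pairsRow
  (Any.map (λ { refl → ∈-map⁺ (i ,_) (∈-filter⁺ (λ k → toℕ i <? toℕ k) (∈-allFin j) i<j) }) (∈-allFin i))

pairs-< : ∀ {i j : Fin n} → (i , j) ∈ pairs n → toℕ i < toℕ j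
pairs-< {n} ij∈ with Any.satisfied (∈-concatMap⁻ pairsRow {xs = allFin n} ij∈)
... | i , ij∈row with ∈-map⁻ (i ,_) ij∈row
...   | j , j∈ , refl = proj₂ (∈-filter⁻ (λ k → toℕ i <? toℕ k) {xs = allFin n} j∈)

pairs-≢ : ∀ {i j : Fin n} → (i , j) ∈ pairs n → i ≢ j
pairs-≢ ij∈ refl = <-irrefl refl (pairs-< ij∈)

pairs-unique : Unique (pairs n)
pairs-unique {n} =
  Unique.concat⁺ (All.tabulate row-unique) (AllPairs.map⁺ (AllPairs.map rows-disjoint (allFin⁺ n)))
  where
  row-unique : ∀ {r} → r ∈ map pairsRow (allFin n) → Unique r
  row-unique r∈ with ∈-map⁻ pairsRow r∈
  ... | i , _ , refl = Unique.map⁺ (cong proj₂) (Unique.filter⁺ (λ k → toℕ i <? toℕ k) (allFin⁺ n))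
  rows-disjoint : ∀ {i i'} → i ≢ i' → Disjoint (pairsRow i) (pairsRow i')
  rows-disjoint {i} {i'} i≢i' (e∈ , e∈') with ∈-map⁻ (i ,_) e∈ | ∈-map⁻ (i' ,_) e∈'
  ... | _ , _ , refl | _ , _ , e≡ = i≢i' (cong proj₁ e≡)

SameEdge : Fin n × Fin n → Fin n × Fin n → Set
SameEdge (x , y) (u , v) = (x ≡ u × y ≡ v) ⊎ (x ≡ v × y ≡ u)

SameEdge-sym : ∀ {e e′ : Fin n × Fin n} → SameEdge e e′ → SameEdge e′ e
SameEdge-sym (inj₁ (refl , refl)) = inj₁ (refl , refl)
SameEdge-sym (inj₂ (refl , refl)) = inj₂ (refl , refl)

SameEdge-trans : ∀ {e e′ e″ : Fin n × Fin n} → SameEdge e e′ → SameEdge e′ e″ → SameEdge e e″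
SameEdge-trans (inj₁ (refl , refl)) s = s
SameEdge-trans (inj₂ (refl , refl)) (inj₁ (refl , refl)) = inj₂ (refl , refl)
SameEdge-trans (inj₂ (refl , refl)) (inj₂ (refl , refl)) = inj₁ (refl , refl)

SameEdge-swap : ∀ {x y u v : Fin n} → SameEdge (x , y) (u , v) → SameEdge (y , x) (u , v)
SameEdge-swap (inj₁ (x≡u , y≡v)) = inj₂ (y≡v , x≡u)
SameEdge-swap (inj₂ (x≡v , y≡u)) = inj₁ (y≡u , x≡v)

pairs-SameEdge : ∀ {e e′ : Fin n × Fin n} → e ∈ pairs n → e′ ∈ pairs n → SameEdge e e′ → e ≡ e′
pairs-SameEdge _ _ (inj₁ (refl , refl)) = refl
pairs-SameEdge e∈ e′∈ (inj₂ (refl , refl)) = ⊥-elim (<-asym (pairs-< e∈) (pairs-< e′∈))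

pairs-orient : ∀ {u v : Fin n} → u ≢ v → ∃[ e ] (e ∈ pairs n × SameEdge e (u , v))
pairs-orient {u = u} {v} u≢v with <-cmp (toℕ u) (toℕ v)
... | tri< u<v _ _ = (u , v) , pairs-mem u<v , inj₁ (refl , refl)
... | tri> _ _ v<u = (v , u) , pairs-mem v<u , inj₂ (refl , refl)
... | tri≈ _ u≡v _ = ⊥-elim (u≢v (toℕ-injective u≡v))

samePair⇔ : ∀ {u v x y : Fin n} → T (samePair u v x y) ⇔ SameEdge (x , y) (u , v)
samePair⇔ {u = u} {v} {x} {y} = mk⇔ to′ from′
  where
  to′ : T (samePair u v x y) → SameEdge (x , y) (u , v)
  to′ h with to (T-∨ {⌊ x ≟ u ⌋ ∧ ⌊ y ≟ v ⌋}) h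
  ... | inj₁ h₁ = let x≡u , y≡v = to (T-∧ {⌊ x ≟ u ⌋}) h₁
                  in inj₁ (toWitness {a? = x ≟ u} x≡u , toWitness {a? = y ≟ v} y≡v)
  ... | inj₂ h₂ = let x≡v , y≡u = to (T-∧ {⌊ x ≟ v ⌋}) h₂
                  in inj₂ (toWitness {a? = x ≟ v} x≡v , toWitness {a? = y ≟ u} y≡u)
  from′ : SameEdge (x , y) (u , v) → T (samePair u v x y)
  from′ (inj₁ (x≡u , y≡v)) = from (T-∨ {⌊ x ≟ u ⌋ ∧ ⌊ y ≟ v ⌋})
    (inj₁ (from T-∧ (fromWitness {a? = x ≟ u} x≡u , fromWitness {a? = y ≟ v} y≡v)))
  from′ (inj₂ (x≡v , y≡u)) = from (T-∨ {⌊ x ≟ u ⌋ ∧ ⌊ y ≟ v ⌋})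
    (inj₂ (from T-∧ (fromWitness {a? = x ≟ v} x≡v , fromWitness {a? = y ≟ u} y≡u)))

samePair-swap : ∀ (u v x y : Fin n) → samePair u v x y ≡ samePair u v y x
samePair-swap u v x y = T-ext (swapped x y) (swapped y x)
  where
  swapped : ∀ x y → T (samePair u v x y) → T (samePair u v y x)
  swapped x y = from (samePair⇔ {u = u} {v} {y} {x}) ∘ SameEdge-swap ∘ to (samePair⇔ {u = u} {v} {x} {y})

samePair-flip : ∀ (u v x y : Fin n) → samePair u v x y ≡ samePair v u x y
samePair-flip u v x y = T-ext (flip-pair u v) (flip-pair v u)
  where
  flip-pair : ∀ u v → T (samePair u v x y) → T (samePair v u x y)
  flip-pair u v h with to (samePair⇔ {u = u} {v} {x} {y}) h
  ... | inj₁ e = from (samePair⇔ {u = v} {u} {x} {y}) (inj₂ e)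
  ... | inj₂ e = from (samePair⇔ {u = v} {u} {x} {y}) (inj₁ e)

countTrue-SameEdge : ∀ {u v : Fin n} → u ≢ v → countTrue (λ z → samePair u v (proj₁ z) (proj₂ z)) (pairs n) ≡ 1
countTrue-SameEdge {n} {u} {v} u≢v with pairs-orient u≢v
... | e , e∈ , e≈ = ≤-antisym
  (countTrue-≤1 pairs-unique λ z z∈ z≈ →
    pairs-SameEdge z∈ e∈ (SameEdge-trans (to samePair⇔ z≈) (SameEdge-sym e≈)))
  (countTrue-pos e∈ (from samePair⇔ e≈))

IsSymmetric : Graph n → Set
IsSymmetric {n} G = ∀ (u v : Fin n) → G u v ≡ G v u

IsLoopless : Graph n → Set
IsLoopless {n} G = ∀ (u : Fin n) → G u u ≡ false

adjacent-sym : ∀ {G : Graph n} {x y} → IsSymmetric G → T (G x y) → T (G y x)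
adjacent-sym {x = x} {y} sym-G = subst T (sym-G x y)

adjacent-≢ : ∀ {G : Graph n} {x y} → IsLoopless G → T (G x y) → x ≢ y
adjacent-≢ {x = x} loopless gxx refl = subst T (loopless x) gxx

sameSide-of-noCrossing-pair : ∀ {G : Graph n} {v i j} → T (noCrossing G v) → (i , j) ∈ pairs n → T (G i j) →
  T (sameSide v i j)
sameSide-of-noCrossing-pair {n} {G} {v} {i} {j} nc ij∈ gij
  with G i j | All.lookup (all⁺ _ (pairs n) nc) ij∈
... | true | h = h

sameSide-of-noCrossing : ∀ {G : Graph n} {v x y} → IsSymmetric G → T (noCrossing G v) → T (G x y) →
  T (sameSide v x y)
sameSide-of-noCrossing {G = G} {v} {x} {y} sym-G nc gxy with <-cmp (toℕ x) (toℕ y)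
... | tri< x<y _ _ = sameSide-of-noCrossing-pair {G = G} {v} nc (pairs-mem x<y) gxy
... | tri> _ _ y<x = subst T (cong not (xor-comm (lookup v y) (lookup v x)))
  (sameSide-of-noCrossing-pair {G = G} {v} nc (pairs-mem y<x) (subst T (sym-G x y) gxy))
... | tri≈ _ x≡y _ rewrite toℕ-injective x≡y | xor-same (lookup v y) = _

data Forest (G : Graph n) : List (Fin n) → List (Fin n × Fin n) → Set where
  []   : Forest G [] []
  root : ∀ {V L t} → Forest G V L → t ∉ V → Forest G (t ∷ V) L
  leaf : ∀ {V L t x} → Forest G V L → t ∉ V → x ∈ V → T (G t x) → Forest G (t ∷ V) ((t , x) ∷ L)

private variable
  G : Graph n
  V : List (Fin n)
  L : List (Fin n × Fin n)

Forest-edges-within : Forest G V L → All (λ e → proj₁ e ∈ V × proj₂ e ∈ V) L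
Forest-edges-within []                = []
Forest-edges-within (root f _)        = All.map (Data.Product.map there there) (Forest-edges-within f)
Forest-edges-within (leaf f _ x∈ _) =
  (here refl , there x∈) ∷ All.map (Data.Product.map there there) (Forest-edges-within f)

Forest-edges : Forest G V L → All (T ∘ uncurry G) L
Forest-edges []               = []
Forest-edges (root f _)       = Forest-edges f
Forest-edges (leaf f _ _ gtx) = gtx ∷ Forest-edges f

Forest-unique : ∀ {G : Graph n} {V L} → Forest G V L → Unique V
Forest-unique []             = []
Forest-unique (root f t∉)     = All.tabulate (λ y∈ t≡y → t∉ (subst (_∈ _) (sym t≡y) y∈)) ∷ Forest-unique f
Forest-unique (leaf f t∉ _ _) = All.tabulate (λ y∈ t≡y → t∉ (subst (_∈ _) (sym t≡y) y∈)) ∷ Forest-unique f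

_∈?_ : (x : Fin n) (xs : List (Fin n)) → Dec (x ∈ xs)
x ∈? xs = Any.any? (x ≟_) xs

Forest-extend : ∀ {G : Graph n} {V L t x} → Forest G V L → t ∉ V → t ≢ x → T (G t x) →
  ∃[ W ] Forest G W ((t , x) ∷ L)
Forest-extend {V = V} {x = x} f t∉ t≢x gtx with x ∈? V
... | yes x∈ = _ , leaf f t∉ x∈ gtx
... | no  x∉ = _ , leaf (root f x∉) (λ { (here t≡x) → t≢x t≡x ; (there t∈) → t∉ t∈ }) (here refl) gtx

allSameSide : List (Fin n × Fin n) → Vec Bool n → Bool
allSameSide L v = all (uncurry (sameSide v)) L

allSameSide-flipAt : ∀ {t : Fin n} L → All (λ e → t ≢ proj₁ e × t ≢ proj₂ e) L → ∀ v →
  allSameSide L (flipAt t v) ≡ allSameSide L v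
allSameSide-flipAt [] [] v = refl
allSameSide-flipAt (e ∷ L) ((t≢ , t≢′) ∷ away) v =
  cong₂ _∧_ (sameSide-flipAt-away t≢ t≢′ v) (allSameSide-flipAt L away v)

countVecs-forest : Forest G V L → countVecs n (allSameSide L) * 2 ^ length L ≡ 2 ^ n
countVecs-forest {n} []        = trans (*-identityʳ _) (countVecs-all n)
countVecs-forest (root f _)    = countVecs-forest f
countVecs-forest {n} {V = t ∷ V} {L = (t , x) ∷ L} (leaf f t∉ x∈ _) = begin
  countVecs n (allSameSide ((t , x) ∷ L)) * (2 * 2 ^ length L)
    ≡⟨ sym (*-assoc (countVecs n (allSameSide ((t , x) ∷ L))) 2 (2 ^ length L)) ⟩
  countVecs n (allSameSide ((t , x) ∷ L)) * 2 * 2 ^ length L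
    ≡⟨ cong (_* 2 ^ length L) (countVecs-halve n (allSameSide L) (avoid x∈) (allSameSide-flipAt L away)) ⟩
  countVecs n (allSameSide L) * 2 ^ length L
    ≡⟨ countVecs-forest f ⟩
  2 ^ n ∎
  where
  open ≡-Reasoning
  avoid : ∀ {y} → y ∈ V → t ≢ y
  avoid y∈ refl = t∉ y∈
  away : All (λ e → t ≢ proj₁ e × t ≢ proj₂ e) L
  away = All.map (Data.Product.map avoid avoid) (Forest-edges-within f)

uncrossedCount : Graph n → ℕ
uncrossedCount {n} G = countTrue (noCrossing G) (allVecs n)

uncrossedCount-forest : ∀ {G : Graph n} {V L} → IsSymmetric G → Forest G V L →
  uncrossedCount G * 2 ^ length L ≤ 2 ^ n
uncrossedCount-forest {n} {G} {L = L} sym-G f = begin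
  uncrossedCount G * 2 ^ length L           ≡⟨ cong (_* 2 ^ length L) (countTrue-allVecs n (noCrossing G)) ⟩
  countVecs n (noCrossing G) * 2 ^ length L ≤⟨ *-monoˡ-≤ (2 ^ length L) (countVecs-mono n uncrossed⇒sameSide) ⟩
  countVecs n (allSameSide L) * 2 ^ length L ≡⟨ countVecs-forest f ⟩
  2 ^ n                                     ∎
  where
  open ≤-Reasoning
  uncrossed⇒sameSide : ∀ v → T (noCrossing G v) → T (allSameSide L v)
  uncrossed⇒sameSide v nc = all⁻ _ (All.map (sameSide-of-noCrossing {G = G} {v} sym-G nc) (Forest-edges f))

fraction-≡ : ∀ a b c d .{{_ : NonZero b}} .{{_ : NonZero d}} → a * d ≡ c * b → (+ a) / b ≡ (+ c) / d
fraction-≡ a (suc b) c (suc d) e = fromℚᵘ-cong {mkℚᵘ (+ a) b} {mkℚᵘ (+ c) d}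
  (*≡* (trans (sym (pos-* a (suc d))) (trans (cong +_ e) (pos-* c (suc b)))))

fraction-≤ : ∀ a b c d .{{_ : NonZero b}} .{{_ : NonZero d}} → a * d ≤ c * b → (+ a) / b ≤ℚ (+ c) / d
fraction-≤ a (suc b) c (suc d) e = toℚᵘ-cancel-≤
  (ℚᵘ.≤-respˡ-≃ (ℚᵘ.≃-sym (toℚᵘ-fromℚᵘ (mkℚᵘ (+ a) b)))
  (ℚᵘ.≤-respʳ-≃ (ℚᵘ.≃-sym (toℚᵘ-fromℚᵘ (mkℚᵘ (+ c) d)))
   (*≤* (subst₂ ℤ._≤_ (pos-* a (suc d)) (pos-* c (suc b)) (+≤+ e)))))

q₀-≤ : ∀ {G : Graph n} k → uncrossedCount G * suc k ≤ 2 ^ n → q₀ G ≤ℚ + 1 / suc k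
q₀-≤ {n} {G} k h =
  fraction-≤ (uncrossedCount G) (2 ^ n) 1 (suc k) {{m^n≢0 2 n}}
    (subst (uncrossedCount G * suc k ≤_) (sym (+-identityʳ (2 ^ n))) h)

q₀-≡ : ∀ {G : Graph n} a b .{{_ : NonZero b}} → uncrossedCount G * b ≡ a * 2 ^ n → q₀ G ≡ + a / b
q₀-≡ {n} {G} a b h = fraction-≡ (uncrossedCount G) (2 ^ n) a b {{m^n≢0 2 n}} h

q₀-emptyG : q₀ (emptyG {n}) ≡ 1ℚ
q₀-emptyG {n} = q₀-≡ {n} {emptyG} 1 1
  (trans (*-identityʳ (uncrossedCount (emptyG {n}))) (trans uncrossed-all (sym (+-identityʳ (2 ^ n)))))
  where
  uncrossed-all : uncrossedCount (emptyG {n}) ≡ 2 ^ n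
  uncrossed-all = trans (countTrue-allVecs n _)
    (trans (countVecs-cong n (λ v → to T-≡ (all⁻ _ (All.universal (λ _ → _) (pairs n))))) (countVecs-all n))

uncrossedCount-single-edge : ∀ {G : Graph n} → IsSymmetric G → ∣ G ∣ₑ ≡ 1 → uncrossedCount G * 2 ≡ 2 ^ n
uncrossedCount-single-edge {n} {G} sym-G one with countTrue-witness (pairs n) (≤-reflexive (sym one))
... | (a , b) , ab∈ , gab = begin
    uncrossedCount G * 2
      ≡⟨ cong (_* 2) (countTrue-allVecs n (noCrossing G)) ⟩
    countVecs n (noCrossing G) * 2
      ≡⟨ cong (_* 2) (countVecs-cong n (λ v → trans (uncrossed⇔sameSide v) (sym (∧-identityʳ _)))) ⟩
    countVecs n (λ v → sameSide v a b ∧ true) * 2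
      ≡⟨ countVecs-halve n (λ _ → true) (pairs-≢ ab∈) (λ _ → refl) ⟩
    countVecs n (λ _ → true)
      ≡⟨ countVecs-all n ⟩
    2 ^ n ∎
  where
  open ≡-Reasoning
  only : ∀ {e} → e ∈ pairs n → T (uncurry G e) → e ≡ (a , b)
  only {e} e∈ ge with ≡-dec _≟_ _≟_ e (a , b)
  ... | yes e≡ = e≡
  ... | no  e≢ with subst (2 ≤_) one (countTrue-≥2 e∈ ab∈ e≢ ge gab)
  ...   | s≤s ()
  uncrossed⇔sameSide : ∀ v → noCrossing G v ≡ sameSide v a b
  uncrossed⇔sameSide v = T-ext (λ nc → sameSide-of-noCrossing {G = G} {v} sym-G nc gab)
    (λ s → all⁻ _ (All.tabulate λ {e} e∈ → edge-sameSide e∈ s))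
    where
    edge-sameSide : ∀ {e} → e ∈ pairs n → T (sameSide v a b) → T (not (uncurry G e) ∨ uncurry (sameSide v) e)
    edge-sameSide {e} e∈ s with uncurry G e in ge
    ... | false = _
    ... | true rewrite only e∈ (subst T (sym ge) _) = s

q₀-single-edge : ∀ {G : Graph n} → IsSymmetric G → ∣ G ∣ₑ ≡ 1 → q₀ G ≡ ½
q₀-single-edge {n} {G} sym-G one =
  q₀-≡ {G = G} 1 2 (trans (uncrossedCount-single-edge sym-G one) (sym (+-identityʳ (2 ^ n))))

q₀-two-edges : ∀ {G : Graph n} {a b c d} → IsSymmetric G → a ≢ b → c ≢ d → ¬ SameEdge (c , d) (a , b) →
  T (G a b) → T (G c d) → q₀ G ≤ℚ + 1 / 4
q₀-two-edges {G = G} {a} {b} {c} {d} sym-G a≢b c≢d c,d≉a,b gab gcd = bound (c ∈? ab) (d ∈? ab)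
  where
  ab = a ∷ b ∷ []
  f : Forest G ab ((a , b) ∷ [])
  f = leaf (root [] (λ ())) (λ { (here a≡b) → a≢b a≡b }) (here refl) gab
  bound : Dec (c ∈ ab) → Dec (d ∈ ab) → q₀ G ≤ℚ + 1 / 4
  bound (no c∉) _       = q₀-≤ {G = G} 3 (uncrossedCount-forest sym-G (proj₂ (Forest-extend f c∉ c≢d gcd)))
  bound (yes _) (no d∉) = q₀-≤ {G = G} 3 (uncrossedCount-forest sym-G
    (proj₂ (Forest-extend f d∉ (c≢d ∘ sym) (adjacent-sym sym-G gcd))))
  bound (yes (here c≡a))         (yes (here d≡a))         = ⊥-elim (c≢d (trans c≡a (sym d≡a)))
  bound (yes (here c≡a))         (yes (there (here d≡b))) = ⊥-elim (c,d≉a,b (inj₁ (c≡a , d≡b)))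
  bound (yes (there (here c≡b))) (yes (here d≡a))         = ⊥-elim (c,d≉a,b (inj₂ (c≡b , d≡a)))
  bound (yes (there (here c≡b))) (yes (there (here d≡b))) = ⊥-elim (c≢d (trans c≡b (sym d≡b)))

q₀-two-or-more-edges : ∀ {G : Graph n} → IsSymmetric G → 2 ≤ ∣ G ∣ₑ → q₀ G ≤ℚ + 1 / 4
q₀-two-or-more-edges {n} {G} sym-G two =
  let (a , b) , (c , d) , ab∈ , cd∈ , ab≢cd , gab , gcd = countTrue-two-witnesses pairs-unique two
  in q₀-two-edges {G = G} sym-G (pairs-≢ ab∈) (pairs-≢ cd∈) (ab≢cd ∘ sym ∘ pairs-SameEdge cd∈ ab∈) gab gcd

Walk : Graph n → Fin n → Fin n → Set
Walk G = Star (λ u v → T (G u v))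

module _ {n} (G : Graph n) where

  reach-step : ∀ {k u v} → T (reach G k u v) → T (reach G (suc k) u v)
  reach-step {k} {u} {v} h = from (T-∨ {reach G k u v}) (inj₁ h)

  reach-snoc : ∀ {k u w v} → T (reach G k u w) → T (G w v) → T (reach G (suc k) u v)
  reach-snoc {k} {u} {w} {v} h g =
    from (T-∨ {reach G k u v}) (inj₂ (any⁺ _ (Any.map (λ { refl → from T-∧ (h , g) }) (∈-allFin w))))

  reach-split : ∀ {k u v} → T (reach G (suc k) u v) → T (reach G k u v) ⊎ ∃[ w ] (T (reach G k u w) × T (G w v))
  reach-split {k} {u} {v} h with to (T-∨ {reach G k u v}) h
  ... | inj₁ r = inj₁ r
  ... | inj₂ r with Any.satisfied (any⁻ _ (allFin n) r)
  ...   | w , rg = inj₂ (w , to T-∧ rg)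

  reach-cons : ∀ {k u x v} → T (G u x) → T (reach G k x v) → T (reach G (suc k) u v)
  reach-cons {zero} {u} {x} {v} g r with toWitness {a? = x ≟ v} r
  ... | refl = reach-snoc {0} {u} {u} (fromWitness {a? = u ≟ u} refl) g
  reach-cons {suc k} {u} {x} {v} g r with reach-split {k} {x} {v} r
  ... | inj₁ r′ = reach-step {suc k} {u} (reach-cons {k} g r′)
  ... | inj₂ (w , r′ , g′) = reach-snoc {suc k} {u} {w} (reach-cons {k} g r′) g′

  reach-weaken : ∀ j {k u v} → T (reach G k u v) → T (reach G (j + k) u v)
  reach-weaken zero    r = r
  reach-weaken (suc j) {k} {u} {v} r = reach-step {j + k} {u} {v} (reach-weaken j {k} r)

  walk-of-reach : ∀ {k u v} → T (reach G k u v) → Walk G u v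
  walk-of-reach {zero} {u} {v} r with toWitness {a? = u ≟ v} r
  ... | refl = ε
  walk-of-reach {suc k} {u} {v} r with reach-split {k} {u} {v} r
  ... | inj₁ r′ = walk-of-reach {k} r′
  ... | inj₂ (w , r′ , g) = walk-of-reach {k} r′ ◅◅ (g ◅ ε)

  reach-of-walk : ∀ {u v} → Walk G u v → ∃[ k ] T (reach G k u v)
  reach-of-walk {u} ε = 0 , fromWitness {a? = u ≟ u} refl
  reach-of-walk (g ◅ w) with reach-of-walk w
  ... | k , r = suc k , reach-cons {k} g r

  -- The sets reached from u grow strictly until they stop growing for good; as they have at most n
  -- elements, they have stabilised after n steps.
  module _ (u : Fin n) where

    Reached : ℕ → Fin n → Set
    Reached k y = T (reach G k u y)

    Stable : ℕ → Set
    Stable k = ∀ j y → Reached (j + k) y → Reached k y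

    stable-of-closed : ∀ k → (∀ y → Reached (suc k) y → Reached k y) → Stable k
    stable-of-closed k closed zero    y r = r
    stable-of-closed k closed (suc j) y r with reach-split {j + k} {u} {y} r
    ... | inj₁ r′ = stable-of-closed k closed j y r′
    ... | inj₂ (w , r′ , g) = closed y (reach-snoc {k} {u} {w} (stable-of-closed k closed j w r′) g)

    stable-suc : ∀ {k} → Stable k → Stable (suc k)
    stable-suc {k} st j y r = reach-step {k} {u} {y} (st (suc j) y (subst (λ m → Reached m y) (+-suc j k) r))

    reachedCount : ℕ → ℕ
    reachedCount k = countTrue (reach G k u) (allFin n)

    stable-or-growing : ∀ k → Stable k ⊎ k < reachedCount k
    stable-or-growing zero = inj₂ (countTrue-pos (∈-allFin u) (fromWitness {a? = u ≟ u} refl))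
    stable-or-growing (suc k) with stable-or-growing k
    ... | inj₁ st = inj₁ (stable-suc st)
    ... | inj₂ k<count with Data.Fin.Properties.any? (λ y → T? (reach G (suc k) u y ∧ not (reach G k u y)))
    ...   | yes (y , new) = let now , before = to (T-∧ {reach G (suc k) u y}) new in
      inj₂ (≤-trans (s≤s k<count) (countTrue-< (λ z → reach-step {k} {u} {z}) (∈-allFin y) now (to T-not before)))
    ...   | no  none = inj₁ (stable-suc (stable-of-closed k closed))
      where
      closed : ∀ y → Reached (suc k) y → Reached k y
      closed y r with T? (reach G k u y)
      ... | yes old = old
      ... | no  new = ⊥-elim (none (y , from T-∧ (r , from T-not new)))

    stable-at-n : Stable n
    stable-at-n with stable-or-growing n
    ... | inj₁ st = st
    ... | inj₂ n<count = ⊥-elim (<-irrefl refl (≤-trans n<count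
      (subst (reachedCount n ≤_) (length-tabulate {n = n} id) (length-filter _ (allFin n)))))

  connected-of-reach : ∀ {k u v} → T (reach G k u v) → T (connected G u v)
  connected-of-reach {k} {u} {v} r =
    stable-at-n u k v (subst (λ m → T (reach G m u v)) (+-comm n k) (reach-weaken n {k} r))

walk⇔connected : ∀ {G : Graph n} {u v} → Walk G u v ⇔ T (connected G u v)
walk⇔connected {n} {G} {u} {v} =
  mk⇔ (λ w → let k , r = reach-of-walk G w in connected-of-reach G {k} {u} {v} r) (walk-of-reach G {n} {u} {v})

walk-reverse : ∀ {G : Graph n} {u v} → IsSymmetric G → Walk G u v → Walk G v u
walk-reverse sym-G = Star.reverse (λ {x} {y} → subst T (sym-G x y))

walk-lift : ∀ {G H : Graph n} {u v} → (∀ {x y} → T (G x y) → Walk H x y) → Walk G u v → Walk H u v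
walk-lift f w = Star.concat (Star.map f w)

walk-mono : ∀ {G H : Graph n} {u v} → (∀ {x y} → T (G x y) → T (H x y)) → Walk G u v → Walk H u v
walk-mono f = Star.map f

walk-from-isolated : ∀ {H : Graph n} {u y} → (∀ x → ¬ T (H u x)) → Walk H u y → u ≡ y
walk-from-isolated isolated ε       = refl
walk-from-isolated isolated (h ◅ _) = ⊥-elim (isolated _ h)

leader : Graph n → Fin n → Bool
leader {n} G v = not (any (λ w → (toℕ w <ᵇ toℕ v) ∧ connected G w v) (allFin n))

leader-below : ∀ {G : Graph n} {a b} → toℕ a < toℕ b → Walk G a b → ¬ T (leader G b)
leader-below {n} {G} {a} {b} a<b w = flip (to T-not)
  (any⁺ _ (Any.map (λ { refl → from T-∧ (<⇒<ᵇ a<b , to walk⇔connected w) }) (∈-allFin a)))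

not-leader : ∀ {G : Graph n} {z} → ¬ T (leader G z) → ∃[ w ] (toℕ w < toℕ z × Walk G w z)
not-leader {n} {G} {z} ¬l with Any.satisfied (any⁻ _ (allFin n) (T-stable (¬l ∘ from T-not)))
... | w , h with to T-∧ h
...   | w<z , w~z = w , <ᵇ⇒< (toℕ w) (toℕ z) w<z , from walk⇔connected w~z

leader-exists : ∀ (G : Graph n) x → ∃[ a ] (T (leader G a) × Walk G a x)
leader-exists {n} G x = go (suc (toℕ x)) x ≤-refl
  where
  go : ∀ m x → toℕ x < m → ∃[ a ] (T (leader G a) × Walk G a x)
  go (suc m) x x<m with T? (leader G x)
  ... | yes l = x , l , ε
  ... | no ¬l with not-leader ¬l
  ...   | w , w<x , w~x with go m w (≤-trans w<x (s≤s⁻¹ x<m))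
  ...     | a , l , a~w = a , l , a~w ◅◅ w~x

leader-mono : ∀ {G H : Graph n} → (∀ {x y} → Walk H x y → Walk G x y) → ∀ z → T (leader G z) → T (leader H z)
leader-mono {H = H} H⇒G z lG with T? (leader H z)
... | yes lH = lH
... | no ¬lH with not-leader ¬lH
...   | w , w<z , w~z = ⊥-elim (leader-below w<z (H⇒G w~z) lG)

components-cong : ∀ {G H : Graph n} → (∀ {u v} → Walk G u v → Walk H u v) →
  (∀ {u v} → Walk H u v → Walk G u v) → components G ≡ components H
components-cong {n} {G} {H} G⇒H H⇒G = countTrue-cong (λ v → cong (not ∘ or) (map-cong (λ w →
  cong ((toℕ w <ᵇ toℕ v) ∧_) (T-ext (to walk⇔connected ∘ G⇒H ∘ from walk⇔connected)
                                     (to walk⇔connected ∘ H⇒G ∘ from walk⇔connected))) (allFin n))) (allFin n)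

-- u and v have distinct H-leaders; in G the larger one is connected to the smaller and stops being a leader,
-- while every G-leader remains an H-leader.
components-< : ∀ {G H : Graph n} {u v} → IsSymmetric G → IsSymmetric H → (∀ {x y} → Walk H x y → Walk G x y) →
  Walk G u v → ¬ Walk H u v → components G < components H
components-< {n} {G} {H} {u} {v} sym-G sym-H H⇒G u~v u≁v with leader-exists H u | leader-exists H v
... | a , la , a~u | b , lb , b~v with <-cmp (toℕ a) (toℕ b)
...   | tri< a<b _ _ = countTrue-< (leader-mono H⇒G) (∈-allFin b) lb
                         (leader-below a<b (H⇒G a~u ◅◅ u~v ◅◅ H⇒G (walk-reverse sym-H b~v)))
...   | tri> _ _ b<a = countTrue-< (leader-mono H⇒G) (∈-allFin a) la
                         (leader-below b<a (walk-reverse sym-G (H⇒G a~u ◅◅ u~v ◅◅ H⇒G (walk-reverse sym-H b~v))))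
...   | tri≈ _ a≡b _ rewrite toℕ-injective a≡b = ⊥-elim (u≁v (walk-reverse sym-H a~u ◅◅ b~v))

removeEdge-sym : ∀ {G : Graph n} u v → IsSymmetric G → IsSymmetric (removeEdge G u v)
removeEdge-sym u v sym-G x y = cong₂ (λ g s → g ∧ not s) (sym-G x y) (samePair-swap u v x y)

removeEdge-⊆ : ∀ {G : Graph n} {u v x y} → T (removeEdge G u v x y) → T (G x y)
removeEdge-⊆ h = proj₁ (to T-∧ h)

removeEdge-keeps : ∀ {G : Graph n} {u v x y} → T (G x y) → ¬ SameEdge (x , y) (u , v) → T (removeEdge G u v x y)
removeEdge-keeps g ≉ = from T-∧ (g , from T-not (≉ ∘ to samePair⇔))

removeEdge-removes : ∀ {G : Graph n} {u v x y} → SameEdge (x , y) (u , v) → ¬ T (removeEdge G u v x y)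
removeEdge-removes ≈ h = to T-not (proj₂ (to T-∧ h)) (from samePair⇔ ≈)

bridge-of-disconnecting : ∀ {G : Graph n} {u v} → IsSymmetric G → T (G u v) → ¬ Walk (removeEdge G u v) u v →
  T (isBridge G u v)
bridge-of-disconnecting {G = G} {u} {v} sym-G guv u≁v = from T-∧ (guv , <⇒<ᵇ
  (components-< sym-G (removeEdge-sym u v sym-G) (walk-mono (removeEdge-⊆ {G = G})) (guv ◅ ε) u≁v))

not-bridge-of-connecting : ∀ {G : Graph n} {u v} → IsSymmetric G → Walk (removeEdge G u v) u v →
  ¬ T (isBridge G u v)
not-bridge-of-connecting {G = G} {u} {v} sym-G u~v bridge =
  <-irrefl (components-cong (walk-lift bypass) (walk-mono (removeEdge-⊆ {G = G})))
           (<ᵇ⇒< _ _ (proj₂ (to (T-∧ {G u v}) bridge)))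
  where
  bypass : ∀ {x y} → T (G x y) → Walk (removeEdge G u v) x y
  bypass {x} {y} gxy with T? (samePair u v x y)
  ... | no  x,y≉u,v = removeEdge-keeps {G = G} gxy (x,y≉u,v ∘ from (samePair⇔ {u = u} {v} {x} {y})) ◅ ε
  ... | yes x,y≈u,v with to (samePair⇔ {u = u} {v} {x} {y}) x,y≈u,v
  ...   | inj₁ (refl , refl) = u~v
  ...   | inj₂ (refl , refl) = walk-reverse (removeEdge-sym u v sym-G) u~v

isBridge-sym : ∀ {G : Graph n} → IsSymmetric G → ∀ u v → isBridge G u v ≡ isBridge G v u
isBridge-sym {G = G} sym-G u v = cong₂ _∧_ (sym-G u v) (cong (components G <ᵇ_)
  (components-cong (walk-mono (λ {x} {y} → subst T (same x y)))
                   (walk-mono (λ {x} {y} → subst T (sym (same x y))))))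
  where
  same : ∀ x y → removeEdge G u v x y ≡ removeEdge G v u x y
  same x y = cong (λ s → G x y ∧ not s) (samePair-flip u v x y)

bridgeless : ∀ {G : Graph n} → IsSymmetric G → IsLoopless G → bridgeCount G ≡ 0 → ∀ u v → ¬ T (isBridge G u v)
bridgeless {G = G} sym-G loopless none u v with <-cmp (toℕ u) (toℕ v)
... | tri< u<v _ _ = countTrue-zero none (pairs-mem u<v)
... | tri> _ _ v<u = countTrue-zero none (pairs-mem v<u) ∘ subst T (isBridge-sym sym-G u v)
... | tri≈ _ u≡v _ rewrite toℕ-injective u≡v = λ b → subst T (loopless v) (proj₁ (to (T-∧ {G v v}) b))

AvoidingStep : Graph n → Fin n → Fin n → Fin n → Set
AvoidingStep G v x y = T (G x y) × x ≢ v × y ≢ v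

first-arrival : ∀ {G : Graph n} {u v} → u ≢ v → Walk G u v → ∃[ w ] (Star (AvoidingStep G v) u w × T (G w v))
first-arrival u≢v ε = ⊥-elim (u≢v refl)
first-arrival {G = G} {u} {v} u≢v (_◅_ {j = x} gux rest) with x ≟ v
... | yes refl = u , ε , gux
... | no  x≢v with first-arrival x≢v rest
...   | w , x⇝w , gwv = w , (gux , u≢v , x≢v) ◅ x⇝w , gwv

-- The walk from u to w avoids v, hence the edge wv; closed up by uv it shows that wv lies on a cycle.
non-bridge-partner : ∀ {G : Graph n} {u v} → IsSymmetric G → u ≢ v → T (G u v) → ¬ T (isBridge G u v) →
  ∃[ w ] (w ≢ u × T (G w v) × ¬ T (isBridge G w v))
non-bridge-partner {G = G} {u} {v} sym-G u≢v guv not-bridge with T? (connected (removeEdge G u v) u v)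
... | no  u≁v = ⊥-elim (not-bridge (bridge-of-disconnecting sym-G guv (u≁v ∘ to walk⇔connected)))
... | yes u~v with first-arrival u≢v (from walk⇔connected u~v)
...   | w , u⇝w , g′wv =
  w , w≢u , removeEdge-⊆ {G = G} g′wv , not-bridge-of-connecting sym-G (w⇝u ◅◅ (guv′ ◅ ε))
  where
  w≢u : w ≢ u
  w≢u refl = removeEdge-removes {G = G} (inj₁ (refl , refl)) g′wv
  G-wv = removeEdge G w v
  keep : ∀ {x y} → AvoidingStep (removeEdge G u v) v x y → T (G-wv x y)
  keep (g , x≢v , y≢v) = removeEdge-keeps {G = G} (removeEdge-⊆ {G = G} g) λ
    { (inj₁ (_ , y≡v)) → y≢v y≡v
    ; (inj₂ (x≡v , _)) → x≢v x≡v }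
  w⇝u : Walk G-wv w u
  w⇝u = walk-reverse (removeEdge-sym w v sym-G) (Star.map keep u⇝w)
  guv′ : T (G-wv u v)
  guv′ = removeEdge-keeps {G = G} guv λ
    { (inj₁ (u≡w , _)) → w≢u (sym u≡w)
    ; (inj₂ (u≡v , _)) → u≢v u≡v }

nonBridgePart-sym : ∀ {G : Graph n} → IsSymmetric G → IsSymmetric (nonBridgePart G)
nonBridgePart-sym sym-G x y = cong₂ (λ g b → g ∧ not b) (sym-G x y) (isBridge-sym sym-G x y)

q₀-nonBridgePart : ∀ {G : Graph n} → IsSymmetric G → IsLoopless G →
  ∣ nonBridgePart G ∣ₑ ≡ 0 ⊎ q₀ (nonBridgePart G) ≤ℚ + 1 / 4
q₀-nonBridgePart {n} {G} sym-G loopless = by-count _ refl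
  where
  H = nonBridgePart G
  two-edges : ∀ {u v} → u ≢ v → T (H u v) → q₀ H ≤ℚ + 1 / 4
  two-edges {u} {v} u≢v huv =
    let guv , nb = to (T-∧ {G u v}) huv
        w , w≢u , gwv , nb′ = non-bridge-partner sym-G u≢v guv (to T-not nb)
        w≢v : w ≢ v
        w≢v = λ w≡v → subst T (loopless v) (subst (λ z → T (G z v)) w≡v gwv)
        distinct : ¬ SameEdge (w , v) (u , v)
        distinct = λ { (inj₁ (w≡u , _)) → w≢u w≡u ; (inj₂ (_ , v≡u)) → u≢v (sym v≡u) }
    in q₀-two-edges {G = H} (nonBridgePart-sym sym-G) u≢v w≢v distinct huv (from T-∧ (gwv , from T-not nb′))
  by-count : ∀ c → ∣ H ∣ₑ ≡ c → ∣ H ∣ₑ ≡ 0 ⊎ q₀ H ≤ℚ + 1 / 4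
  by-count zero    count = inj₁ count
  by-count (suc _) count =
    let (u , v) , uv∈ , huv = countTrue-witness (pairs n) (subst (1 ≤_) (sym count) (s≤s z≤n))
    in inj₂ (two-edges (pairs-≢ uv∈) huv)

EdgesWithin : Graph n → List (Fin n) → Set
EdgesWithin G V = ∀ {x y} → T (G x y) → x ∈ V

pairsIn : List (Fin n) → List (Fin n × Fin n)
pairsIn []      = []
pairsIn (x ∷ V) = map (x ,_) V ++ pairsIn V

pairsIn-complete : ∀ {V : List (Fin n)} {x y} → x ∈ V → y ∈ V → x ≢ y →
  ∃[ e ] (e ∈ pairsIn V × SameEdge (x , y) e)
pairsIn-complete (here refl) (here refl) x≢y = ⊥-elim (x≢y refl)
pairsIn-complete {V = x ∷ V} {y = y} (here refl) (there y∈) _ =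
  (x , y) , ∈-++⁺ˡ (∈-map⁺ (x ,_) y∈) , inj₁ (refl , refl)
pairsIn-complete {V = y ∷ V} {x = x} (there x∈) (here refl) _ =
  (y , x) , ∈-++⁺ˡ (∈-map⁺ (y ,_) x∈) , inj₂ (refl , refl)
pairsIn-complete {V = z ∷ V} (there x∈) (there y∈) x≢y with pairsIn-complete x∈ y∈ x≢y
... | e , e∈ , e≈ = e , ∈-++⁺ʳ (map (z ,_) V) e∈ , e≈

pairsIn-within : ∀ {V : List (Fin n)} {e} → e ∈ pairsIn V → proj₁ e ∈ V × proj₂ e ∈ V
pairsIn-within {V = x ∷ V} e∈ with ∈-++⁻ (map (x ,_) V) e∈
... | inj₁ e∈row with ∈-map⁻ (x ,_) e∈row
...   | y , y∈ , refl = here refl , there y∈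
pairsIn-within {V = x ∷ V} e∈ | inj₂ e∈rest = Data.Product.map there there (pairsIn-within e∈rest)

pairsIn-distinct : ∀ {V : List (Fin n)} → Unique V →
  AllPairs (λ e e′ → ¬ SameEdge e e′) (pairsIn V) × All (uncurry _≢_) (pairsIn V)
pairsIn-distinct {V = []} [] = [] , []
pairsIn-distinct {V = x ∷ V} (x∉ ∷ u) with pairsIn-distinct u
... | distinct , proper = AllPairs.++⁺ (AllPairs.map⁺ (AllPairs.map row-distinct u)) distinct
                            (All.map⁺ (All.universal (λ _ → row-apart) V))
                        , All.++⁺ (All.map⁺ x∉) proper
  where
  row-distinct : ∀ {y y′} → y ≢ y′ → ¬ SameEdge (x , y) (x , y′)
  row-distinct y≢y′ (inj₁ (_ , y≡y′)) = y≢y′ y≡y′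
  row-distinct y≢y′ (inj₂ (x≡y′ , y≡x)) = y≢y′ (trans y≡x x≡y′)
  row-apart : ∀ {y} → All (λ e′ → ¬ SameEdge (x , y) e′) (pairsIn V)
  row-apart = All.tabulate λ e′∈ → λ
    { (inj₁ (refl , _)) → All.lookup x∉ (proj₁ (pairsIn-within e′∈)) refl
    ; (inj₂ (refl , _)) → All.lookup x∉ (proj₂ (pairsIn-within e′∈)) refl }

Unique-resp-↭ : ∀ {V W : List (Fin n)} → V ↭ W → Unique V → Unique W
Unique-resp-↭ V↭W = Permutation.Unique-resp-↭ (Relation.Binary.PropositionalEquality.setoid _) (↭⇒↭ₛ V↭W)

G-resp-SameEdge : ∀ {G : Graph n} {e e′} → IsSymmetric G → SameEdge e e′ → uncurry G e ≡ uncurry G e′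
G-resp-SameEdge sym-G (inj₁ (refl , refl)) = refl
G-resp-SameEdge {e = x , y} sym-G (inj₂ (refl , refl)) = sym-G x y

edgeFormula : Graph n → List (Fin n × Fin n) → Graph n
edgeFormula G Ps x y = any (λ e → uncurry G e ∧ uncurry samePair e x y) Ps

determined-by-pairsIn : ∀ {G : Graph n} {V} → IsSymmetric G → IsLoopless G → EdgesWithin G V →
  ∀ x y → G x y ≡ edgeFormula G (pairsIn V) x y
determined-by-pairsIn {G = G} {V} sym-G loopless within x y = T-ext edge⇒formula formula⇒edge
  where
  edge⇒formula : T (G x y) → T (edgeFormula G (pairsIn V) x y)
  edge⇒formula gxy with pairsIn-complete (within gxy) (within (subst T (sym-G x y) gxy)) x≢y
    where x≢y = λ { refl → subst T (loopless x) gxy }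
  ... | e , e∈ , e≈ =
    any⁺ _ (Any.map (λ { refl → from T-∧ (subst T (G-resp-SameEdge sym-G e≈) gxy , from samePair⇔ e≈) }) e∈)
  formula⇒edge : T (edgeFormula G (pairsIn V) x y) → T (G x y)
  formula⇒edge h with Any.satisfied (any⁻ _ (pairsIn V) h)
  ... | (u , v) , ge∧e≈ with to (T-∧ {G u v}) ge∧e≈
  ...   | ge , e≈ = subst T (sym (G-resp-SameEdge {G = G} sym-G (to (samePair⇔ {u = u} {v} {x} {y}) e≈))) ge

countTrue-edgeFormula : ∀ (G : Graph n) Ps → AllPairs (λ e e′ → ¬ SameEdge e e′) Ps → All (uncurry _≢_) Ps →
  countTrue (uncurry (edgeFormula G Ps)) (pairs n) ≡ countTrue (uncurry G) Ps
countTrue-edgeFormula {n} G [] _ _ = countTrue-none {xs = pairs n} {p = uncurry (edgeFormula G [])} (λ _ _ ())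
countTrue-edgeFormula {n} G ((u , v) ∷ Ps) (uv≉ ∷ distinct) (u≢v ∷ proper) =
  trans (countTrue-∨ (pairs n) disjoint)
        (trans (cong (_+_ _) (countTrue-edgeFormula G Ps distinct proper)) head)
  where
  onUV : Fin n × Fin n → Bool
  onUV z = G u v ∧ samePair u v (proj₁ z) (proj₂ z)
  disjoint : ∀ {z} → z ∈ pairs n → T (onUV z) → ¬ T (uncurry (edgeFormula G Ps) z)
  disjoint {x , y} _ h h′ with find (any⁻ _ Ps h′)
  ... | (u′ , v′) , uv′∈ , h″ = All.lookup uv≉ uv′∈ (SameEdge-trans (SameEdge-sym z≈uv) z≈uv′)
    where
    z≈uv = to (samePair⇔ {u = u} {v} {x} {y}) (proj₂ (to (T-∧ {G u v}) h))
    z≈uv′ = to (samePair⇔ {u = u′} {v′} {x} {y}) (proj₂ (to (T-∧ {G u′ v′}) h″))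
  head : countTrue (λ z → G u v ∧ samePair u v (proj₁ z) (proj₂ z)) (pairs n) + countTrue (uncurry G) Ps
       ≡ countTrue (uncurry G) ((u , v) ∷ Ps)
  head with G u v
  ... | true  = cong (_+ countTrue (uncurry G) Ps) (countTrue-SameEdge u≢v)
  ... | false = cong (_+ countTrue (uncurry G) Ps) (countTrue-none {xs = pairs n} {p = λ _ → false} (λ _ _ ()))

edgeCount-pairsIn : ∀ {G : Graph n} {V} → IsSymmetric G → IsLoopless G → Unique V → EdgesWithin G V →
  ∣ G ∣ₑ ≡ countTrue (uncurry G) (pairsIn V)
edgeCount-pairsIn {n} {G} {V} sym-G loopless unique within =
  trans (countTrue-cong (λ e → determined-by-pairsIn sym-G loopless within (proj₁ e) (proj₂ e)) (pairs n))
        (uncurry (countTrue-edgeFormula G (pairsIn V)) (pairsIn-distinct unique))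

Odd : ℕ → Set
Odd m = ∃[ k ] m ≡ 2 * k + 1

¬Odd-double : ∀ m → ¬ Odd (2 * m)
¬Odd-double m (k , 2m≡2k+1) = even≢odd m k (trans 2m≡2k+1 (+-comm (2 * k) 1))

MinDegree2 : Graph n → Set
MinDegree2 G = ∀ {u v} → T (G u v) → ∃[ w ] (T (G u w) × w ≢ v)

minDegree2-of-bridgeless : ∀ {G : Graph n} → IsSymmetric G → IsLoopless G → (∀ u v → ¬ T (isBridge G u v)) →
  MinDegree2 G
minDegree2-of-bridgeless {G = G} sym-G loopless no-bridge {u} {v} guv
  with Data.Fin.Properties.any? (λ w → T? (G u w ∧ not ⌊ w ≟ v ⌋))
... | yes (w , h) = let guw , w≢v = to (T-∧ {G u w}) h in w , guw , toWitnessFalse {a? = w ≟ v} w≢v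
... | no  none = ⊥-elim (no-bridge u v (bridge-of-disconnecting sym-G guv (u≢v ∘ walk-from-isolated isolated)))
  where
  u≢v : u ≢ v
  u≢v refl = subst T (loopless u) guv
  isolated : ∀ x → ¬ T (removeEdge G u v u x)
  isolated x h = case x ≟ v of λ
    { (yes x≡v) → removeEdge-removes {G = G} (inj₁ (refl , x≡v)) h
    ; (no  x≢v) → none (x , from T-∧ (removeEdge-⊆ {G = G} h , fromWitnessFalse {a? = x ≟ v} x≢v)) }

LeavingEdge : Graph n → List (Fin n) → Set
LeavingEdge G V = ∃[ x ] ∃[ t ] (x ∈ V × t ∉ V × T (G x t))

OutsideEdge : Graph n → List (Fin n) → Set
OutsideEdge G V = ∃[ y ] ∃[ z ] (y ∉ V × T (G y z))

Closed : Graph n → List (Fin n) → Set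
Closed G V = ∀ {x t} → x ∈ V → T (G x t) → t ∈ V

module _ {G : Graph n} where

  leaving-edge-or-closed : ∀ V → LeavingEdge G V ⊎ Closed G V
  leaving-edge-or-closed V
    with Data.Fin.Properties.any? (λ x → Data.Fin.Properties.any? (λ t →
           (x ∈? V) ×-dec ¬? (t ∈? V) ×-dec T? (G x t)))
  ... | yes (x , t , leaving) = inj₁ (x , t , leaving)
  ... | no  none = inj₂ λ {x} {t} x∈ gxt → case t ∈? V of λ
    { (yes t∈) → t∈
    ; (no  t∉) → ⊥-elim (none (x , t , x∈ , t∉ , gxt)) }

  outside-edge-or-within : ∀ V → OutsideEdge G V ⊎ EdgesWithin G V
  outside-edge-or-within V
    with Data.Fin.Properties.any? (λ y → Data.Fin.Properties.any? (λ z → ¬? (y ∈? V) ×-dec T? (G y z)))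
  ... | yes (y , z , outside) = inj₁ (y , z , outside)
  ... | no  none = inj₂ λ {y} {z} gyz → case y ∈? V of λ
    { (yes y∈) → y∈
    ; (no  y∉) → ⊥-elim (none (y , z , y∉ , gyz)) }

  both-neighbours : ∀ {v p q y₀} → MinDegree2 G → (∀ {y} → T (G v y) → y ≡ p ⊎ y ≡ q) → T (G v y₀) →
    T (G v p) × T (G v q)
  both-neighbours deg2 nbrs gy₀ with deg2 gy₀
  ... | y₁ , gy₁ , y₁≢y₀ with nbrs gy₀ | nbrs gy₁
  ...   | inj₁ refl | inj₁ refl = ⊥-elim (y₁≢y₀ refl)
  ...   | inj₁ refl | inj₂ refl = gy₀ , gy₁
  ...   | inj₂ refl | inj₁ refl = gy₁ , gy₀
  ...   | inj₂ refl | inj₂ refl = ⊥-elim (y₁≢y₀ refl)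

  module _ (sym-G : IsSymmetric G) (loopless : IsLoopless G) (deg2 : MinDegree2 G) where

    neighbour-within : ∀ {V v y} → EdgesWithin G V → T (G v y) → y ∈ V × y ≢ v
    neighbour-within within gvy = within (adjacent-sym sym-G gvy) , adjacent-≢ loopless gvy ∘ sym

    triangle-of-support : ∀ {a b c y₀ y₁} → Unique (a ∷ b ∷ c ∷ []) → EdgesWithin G (a ∷ b ∷ c ∷ []) →
      T (G a y₀) → T (G b y₁) → IsTriangle G
    triangle-of-support {a} {b} {c} ((a≢b ∷ a≢c ∷ []) ∷ (b≢c ∷ []) ∷ [] ∷ []) within ga gb =
      a , b , c , a≢b , b≢c , a≢c , λ x y → trans (determined-by-pairsIn sym-G loopless within x y)
        (triangle-formula (samePair a b x y) (samePair a c x y) (samePair b c x y)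
          (to T-≡ (proj₁ at-a)) (to T-≡ (proj₂ at-a)) (to T-≡ (proj₂ at-b)))
      where
      at-a : T (G a b) × T (G a c)
      at-a = both-neighbours deg2 (λ g → case neighbour-within within g of λ
        { (here y≡a , y≢a) → ⊥-elim (y≢a y≡a)
        ; (there (here y≡b) , _) → inj₁ y≡b
        ; (there (there (here y≡c)) , _) → inj₂ y≡c }) ga
      at-b : T (G b a) × T (G b c)
      at-b = both-neighbours deg2 (λ g → case neighbour-within within g of λ
        { (here y≡a , _) → inj₁ y≡a
        ; (there (here y≡b) , y≢b) → ⊥-elim (y≢b y≡b)
        ; (there (there (here y≡c)) , _) → inj₂ y≡c }) gb
      triangle-formula : ∀ {g₁ g₂ g₃} s₁ s₂ s₃ → g₁ ≡ true → g₂ ≡ true → g₃ ≡ true →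
        (g₁ ∧ s₁) ∨ ((g₂ ∧ s₂) ∨ ((g₃ ∧ s₃) ∨ false)) ≡ s₁ ∨ (s₃ ∨ s₂)
      triangle-formula s₁ s₂ s₃ refl refl refl =
        cong (s₁ ∨_) (trans (cong (s₂ ∨_) (∨-identityʳ s₃)) (∨-comm s₂ s₃))

    -- With pq missing, minimum degree two forces pr, ps, qr and qs; without rs the edge count would be four.
    K4⁻-of-non-edge : ∀ {V r s p q y₀ y₁} → V ↭ (r ∷ s ∷ p ∷ q ∷ []) → Unique V → EdgesWithin G V →
      T (G p y₀) → T (G q y₁) → ¬ T (G p q) → Odd ∣ G ∣ₑ → IsK4minus G
    K4⁻-of-non-edge {V} {r} {s} {p} {q} V↭W unique within gp gq ¬gpq odd
      with Unique-resp-↭ V↭W unique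
    ... | (r≢s ∷ r≢p ∷ r≢q ∷ []) ∷ (s≢p ∷ s≢q ∷ []) ∷ (p≢q ∷ []) ∷ [] ∷ [] =
      r , s , p , q , r≢s , r≢p , r≢q , s≢p , s≢q , p≢q , λ x y →
        trans (determined-by-pairsIn sym-G loopless withinW x y)
          (K4⁻-formula (samePair r s x y) (samePair r p x y) (samePair r q x y)
                       (samePair s p x y) (samePair s q x y) (samePair p q x y)
                       (to T-≡ grs) (to T-≡ grp) (to T-≡ grq) (to T-≡ gsp) (to T-≡ gsq)
                       (to T-not-≡ (from T-not ¬gpq)))
      where
      W = r ∷ s ∷ p ∷ q ∷ []
      withinW : EdgesWithin G W
      withinW = ∈-resp-↭ V↭W ∘ within
      others : ∀ {y} → y ∈ W → y ≢ p → y ≢ q → y ≡ r ⊎ y ≡ s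
      others (here y≡r) _ _ = inj₁ y≡r
      others (there (here y≡s)) _ _ = inj₂ y≡s
      others (there (there (here y≡p))) y≢p _ = ⊥-elim (y≢p y≡p)
      others (there (there (there (here y≡q)))) _ y≢q = ⊥-elim (y≢q y≡q)
      at-p : T (G p r) × T (G p s)
      at-p = both-neighbours deg2 (λ g → let y∈ , y≢p = neighbour-within withinW g
                                         in others y∈ y≢p (λ { refl → ¬gpq g })) gp
      at-q : T (G q r) × T (G q s)
      at-q = both-neighbours deg2 (λ g → let y∈ , y≢q = neighbour-within withinW g
                                         in others y∈ (λ { refl → ¬gpq (adjacent-sym sym-G g) }) y≢q) gq
      grp = adjacent-sym sym-G (proj₁ at-p)
      gsp = adjacent-sym sym-G (proj₂ at-p)
      grq = adjacent-sym sym-G (proj₁ at-q)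
      gsq = adjacent-sym sym-G (proj₂ at-q)
      grs : T (G r s)
      grs = T-stable λ ¬grs → ¬Odd-double 2 (subst Odd (four-edges ¬grs) odd)
        where
        count-4 : ∀ {g₁ g₂ g₃ g₄ g₅ g₆} → g₁ ≡ false → g₂ ≡ true → g₃ ≡ true → g₄ ≡ true → g₅ ≡ true →
          g₆ ≡ false → countTrue id (g₁ ∷ g₂ ∷ g₃ ∷ g₄ ∷ g₅ ∷ g₆ ∷ []) ≡ 4
        count-4 refl refl refl refl refl refl = refl
        four-edges : ¬ T (G r s) → ∣ G ∣ₑ ≡ 4
        four-edges ¬grs = trans (edgeCount-pairsIn sym-G loopless (Unique-resp-↭ V↭W unique) withinW)
          (trans (countTrue-map-id (uncurry G) (pairsIn W))
            (count-4 (to T-not-≡ (from T-not ¬grs)) (to T-≡ grp) (to T-≡ grq) (to T-≡ gsp) (to T-≡ gsq)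
                     (to T-not-≡ (from T-not ¬gpq))))
      K4⁻-formula : ∀ {g₁ g₂ g₃ g₄ g₅ g₆} s₁ s₂ s₃ s₄ s₅ s₆ →
        g₁ ≡ true → g₂ ≡ true → g₃ ≡ true → g₄ ≡ true → g₅ ≡ true → g₆ ≡ false →
        (g₁ ∧ s₁) ∨ ((g₂ ∧ s₂) ∨ ((g₃ ∧ s₃) ∨ ((g₄ ∧ s₄) ∨ ((g₅ ∧ s₅) ∨ ((g₆ ∧ s₆) ∨ false)))))
          ≡ s₁ ∨ s₂ ∨ s₃ ∨ s₄ ∨ s₅
      K4⁻-formula s₁ s₂ s₃ s₄ s₅ s₆ refl refl refl refl refl refl =
        cong (λ z → s₁ ∨ s₂ ∨ s₃ ∨ s₄ ∨ z) (∨-identityʳ s₅)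

    q₀-four-edges : ∀ {V e₁ e₂ e₃ e₄} → Forest G V (e₁ ∷ e₂ ∷ e₃ ∷ e₄ ∷ []) → q₀ G ≤ℚ + 1 / 16
    q₀-four-edges f = q₀-≤ {G = G} 15 (uncrossedCount-forest sym-G f)

    -- Six edges would be an even number, so some pair of the four vertices is a non-edge; a permutation moves
    -- it to the last position.
    K4⁻-of-support : ∀ {a b c d y₀ y₁ y₂ y₃} → Unique (d ∷ c ∷ b ∷ a ∷ []) →
      EdgesWithin G (d ∷ c ∷ b ∷ a ∷ []) → T (G d y₀) → T (G c y₁) → T (G b y₂) → T (G a y₃) →
      Odd ∣ G ∣ₑ → IsK4minus G
    K4⁻-of-support {a} {b} {c} {d} unique within gd gc gb ga odd
      with all? (T? ∘ uncurry G) (pairsIn (d ∷ c ∷ b ∷ a ∷ []))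
    ... | yes (g₁ ∷ g₂ ∷ g₃ ∷ g₄ ∷ g₅ ∷ g₆ ∷ []) = ⊥-elim (¬Odd-double 3 (subst Odd six-edges odd))
      where
      count-6 : ∀ {h₁ h₂ h₃ h₄ h₅ h₆} → h₁ ≡ true → h₂ ≡ true → h₃ ≡ true → h₄ ≡ true → h₅ ≡ true → h₆ ≡ true →
        countTrue id (h₁ ∷ h₂ ∷ h₃ ∷ h₄ ∷ h₅ ∷ h₆ ∷ []) ≡ 6
      count-6 refl refl refl refl refl refl = refl
      six-edges : ∣ G ∣ₑ ≡ 6
      six-edges = trans (edgeCount-pairsIn sym-G loopless unique within)
        (trans (countTrue-map-id (uncurry G) (pairsIn (d ∷ c ∷ b ∷ a ∷ [])))
          (count-6 (to T-≡ g₁) (to T-≡ g₂) (to T-≡ g₃) (to T-≡ g₄) (to T-≡ g₅) (to T-≡ g₆)))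
    ... | no incomplete with ¬All⇒Any¬ (T? ∘ uncurry G) (pairsIn (d ∷ c ∷ b ∷ a ∷ [])) incomplete
    ...   | here ¬gdc =
      K4⁻-of-non-edge (shifts (d ∷ c ∷ []) (b ∷ a ∷ [])) unique within gd gc ¬gdc odd
    ...   | there (here ¬gdb) =
      K4⁻-of-non-edge (↭-trans (swap d c ↭-refl) (prep c (shift a (d ∷ b ∷ []) []))) unique within gd gb ¬gdb odd
    ...   | there (there (here ¬gda)) =
      K4⁻-of-non-edge (shifts (d ∷ []) (c ∷ b ∷ []) {a ∷ []}) unique within gd ga ¬gda odd
    ...   | there (there (there (here ¬gcb))) =
      K4⁻-of-non-edge (prep d (shift a (c ∷ b ∷ []) [])) unique within gc gb ¬gcb odd
    ...   | there (there (there (there (here ¬gca)))) =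
      K4⁻-of-non-edge (prep d (swap c b ↭-refl)) unique within gc ga ¬gca odd
    ...   | there (there (there (there (there (here ¬gba))))) =
      K4⁻-of-non-edge ↭-refl unique within gb ga ¬gba odd

    -- A vertex outside a closed vertex set lies in another component and, with two of its neighbours, adds two
    -- forest edges.
    second-component : ∀ {V L y z} → Forest G V L → Closed G V → y ∉ V → T (G y z) →
      ∃[ u ] Forest G (u ∷ z ∷ y ∷ V) ((u , y) ∷ (z , y) ∷ L)
    second-component {V} {y = y} {z} f closed y∉ gyz with deg2 gyz
    ... | u , gyu , u≢z =
      u , leaf (leaf (root f y∉) z∉ (here refl) (adjacent-sym sym-G gyz))
               u∉ (there (here refl)) (adjacent-sym sym-G gyu)
      where
      z∉ : z ∉ y ∷ V
      z∉ (here z≡y)  = adjacent-≢ loopless gyz (sym z≡y)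
      z∉ (there z∈) = y∉ (closed z∈ (adjacent-sym sym-G gyz))
      u∉ : u ∉ z ∷ y ∷ V
      u∉ (here u≡z)         = u≢z u≡z
      u∉ (there (here u≡y)) = adjacent-≢ loopless gyu (sym u≡y)
      u∉ (there (there u∈)) = y∉ (closed u∈ (adjacent-sym sym-G gyu))

    forest-or-small-support : ∀ {a b} → a ≢ b → T (G a b) → Odd ∣ G ∣ₑ →
      q₀ G ≤ℚ + 1 / 16 ⊎ IsTriangle G ⊎ IsK4minus G
    forest-or-small-support {a} {b} a≢b gab odd = grow₁ (leaving-edge-or-closed (b ∷ a ∷ []))
      where
      Outcome = q₀ G ≤ℚ + 1 / 16 ⊎ IsTriangle G ⊎ IsK4minus G
      gb = adjacent-sym sym-G gab
      F₁ : Forest G (b ∷ a ∷ []) ((b , a) ∷ [])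
      F₁ = leaf (root [] (λ ())) (λ { (here b≡a) → a≢b (sym b≡a) }) (here refl) gb

      grow₃ : ∀ {c d e₁ e₂ e₃ y y′} → Forest G (d ∷ c ∷ b ∷ a ∷ []) (e₁ ∷ e₂ ∷ e₃ ∷ []) →
        T (G c y) → T (G d y′) → OutsideEdge G (d ∷ c ∷ b ∷ a ∷ []) ⊎ EdgesWithin G (d ∷ c ∷ b ∷ a ∷ []) → Outcome
      grow₃ F₃ gc gd (inj₁ (y , z , y∉ , gyz)) =
        inj₁ (q₀-four-edges (proj₂ (Forest-extend F₃ y∉ (adjacent-≢ loopless gyz) gyz)))
      grow₃ F₃ gc gd (inj₂ within) = inj₂ (inj₂ (K4⁻-of-support (Forest-unique F₃) within gd gc gb gab odd))

      closed₂ : ∀ {c e₁ e₂ y} → Forest G (c ∷ b ∷ a ∷ []) (e₁ ∷ e₂ ∷ []) → T (G c y) →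
        Closed G (c ∷ b ∷ a ∷ []) → OutsideEdge G (c ∷ b ∷ a ∷ []) ⊎ EdgesWithin G (c ∷ b ∷ a ∷ []) → Outcome
      closed₂ F₂ gc closed (inj₁ (y , z , y∉ , gyz)) =
        inj₁ (q₀-four-edges (proj₂ (second-component F₂ closed y∉ gyz)))
      closed₂ F₂ gc closed (inj₂ within) = inj₂ (inj₁ (triangle-of-support (Forest-unique F₂) within gc gb))

      grow₂ : ∀ {c e₁ e₂ y} → Forest G (c ∷ b ∷ a ∷ []) (e₁ ∷ e₂ ∷ []) → T (G c y) →
        LeavingEdge G (c ∷ b ∷ a ∷ []) ⊎ Closed G (c ∷ b ∷ a ∷ []) → Outcome
      grow₂ F₂ gc (inj₁ (x , d , x∈ , d∉ , gxd)) =
        grow₃ (leaf F₂ d∉ x∈ (adjacent-sym sym-G gxd)) gc (adjacent-sym sym-G gxd) (outside-edge-or-within _)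
      grow₂ F₂ gc (inj₂ closed) = closed₂ F₂ gc closed (outside-edge-or-within _)

      stuck : ¬ Closed G (b ∷ a ∷ [])
      stuck closed with deg2 gab
      ... | w , gaw , w≢b with closed (there (here refl)) gaw
      ...   | here w≡b         = w≢b w≡b
      ...   | there (here w≡a) = adjacent-≢ loopless gaw (sym w≡a)

      grow₁ : LeavingEdge G (b ∷ a ∷ []) ⊎ Closed G (b ∷ a ∷ []) → Outcome
      grow₁ (inj₁ (x , c , x∈ , c∉ , gxc)) =
        grow₂ (leaf F₁ c∉ x∈ (adjacent-sym sym-G gxc)) (adjacent-sym sym-G gxc) (leaving-edge-or-closed _)
      grow₁ (inj₂ closed) = ⊥-elim (stuck closed)

q₀-bridgeless-odd : ∀ {G : Graph n} → IsSymmetric G → IsLoopless G → bridgeCount G ≡ 0 → Odd ∣ G ∣ₑ →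
  q₀ G ≤ℚ + 1 / 16 ⊎ IsTriangle G ⊎ IsK4minus G
q₀-bridgeless-odd {n} {G} sym-G loopless none odd@(k , count≡) =
  let (a , b) , ab∈ , gab = countTrue-witness (pairs n) (subst (1 ≤_) (sym count≡) (m≤n+m 1 (2 * k)))
      deg2 = minDegree2-of-bridgeless sym-G loopless (bridgeless sym-G loopless none)
  in forest-or-small-support sym-G loopless deg2 (pairs-≢ ab∈) gab odd

lemma3p2 : (n : ℕ) (G : Graph n) → IsSubgraphOfK G →
    ((q₀ (emptyG {n}) ≡ 1ℚ)
    × (∣ G ∣ₑ ≡ 1 → q₀ G ≡ ½)
    × (2 ≤ ∣ G ∣ₑ → q₀ G ≤ℚ (+ 1 / 4)))
    × (bridgeCount G ≡ 0 → (∃[ k ] ∣ G ∣ₑ ≡ 2 * k + 1) →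
        (q₀ G ≤ℚ (+ 1 / 16)) ⊎ IsTriangle G ⊎ IsK4minus G)
    × (∣ nonBridgePart G ∣ₑ ≡ 0 ⊎ q₀ (nonBridgePart G) ≤ℚ (+ 1 / 4))
lemma3p2 n G (sym-G , loopless) =
  (q₀-emptyG {n} , q₀-single-edge {G = G} sym-G , q₀-two-or-more-edges {G = G} sym-G) ,
  q₀-bridgeless-odd {G = G} sym-G loopless ,
  q₀-nonBridgePart {G = G} sym-G loopless
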